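{- Let $P,Q$ be binary predicate symbols, $r_1,r_2$ constant symbols, $t_1,t_2$ unary function symbols, and $\alpha,\beta_1,\beta_2$ variables. Consider the sequent $\forall x.(P(x,t_1x)\land Q(x,t_2x))\vdash\exists x,y.(P(r_1,x)\land Q(r_2,y))$, the schematic $\Pi_2$-grammar with nonterminals $\tau,\alpha,\beta_1,\beta_2$ and productions $\tau\to h_F\alpha$, $\tau\to h_G\beta_1\beta_2$, $\alpha\to r_1\mid r_2$, $\beta_2\to t_1r_2\mid t_2r_2$, $\beta_1\to t_1r_1\mid t_2r_1$, and the corresponding schematic extended Herbrand sequent $$S(X):\quad P(\alpha,t_1\alpha)\land Q(\alpha,t_2\alpha),\ X(\alpha,t_1\alpha)\lor X(\alpha,t_2\alpha)\to X(r_1,\beta_1)\land X(r_2,\beta_2)\ \vdash\ P(r_1,\beta_1)\land Q(r_2,\beta_2),$$ where $X$ is a binary predicate variable. Then this schematic extended Herbrand sequent has no solution: there is no formula $C$ (with free variables among the designated variables $x,y$) such that $S(C)$, obtained by replacing each $X(s,t)$ by $C[x\backslash s,y\backslash t]$, is a tautology.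
   Context: A sequent is a tautology if it is valid in classical first-order logic. $h_F,h_G$ are auxiliary function symbols representing the instances of the quantified formulas of the antecedent and succedent. -}

module Defs where

open import Data.Nat using (ℕ; zero; suc)
open import Data.Fin using (Fin; zero; suc)
open import Data.Bool using (Bool; true; false; not; _∧_; _∨_)
open import Data.List using (List; []; _∷_)
open import Data.Product using (_×_)
open import Relation.Binary.PropositionalEquality using (_≡_)

data Term (n : ℕ) : Set where
  var : Fin n → Term n
  r₁ r₂ : Term n
  t₁ t₂ : Term n → Term n

infixr 6 _∧'_
infixr 5 _∨'_
infixr 4 _⇒'_

data Fm (n : ℕ) : Set where
  ⊥'          : Fm n
  P Q         : Term n → Term n → Fm n
  ¬'_         : Fm n → Fm n
  _∧'_ _∨'_ _⇒'_ : Fm n → Fm n → Fm n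
  ∀' ∃'       : Fm (suc n) → Fm n

renT : ∀ {m n} → (Fin m → Fin n) → Term m → Term n
renT ρ (var i) = var (ρ i)
renT ρ r₁ = r₁
renT ρ r₂ = r₂
renT ρ (t₁ s) = t₁ (renT ρ s)
renT ρ (t₂ s) = t₂ (renT ρ s)

Sub : ℕ → ℕ → Set
Sub m n = Fin m → Term n

substT : ∀ {m n} → Sub m n → Term m → Term n
substT σ (var i) = σ i
substT σ r₁ = r₁
substT σ r₂ = r₂
substT σ (t₁ s) = t₁ (substT σ s)
substT σ (t₂ s) = t₂ (substT σ s)

liftS : ∀ {m n} → Sub m n → Sub (suc m) (suc n)
liftS σ zero = var zero
liftS σ (suc i) = renT suc (σ i)

subst : ∀ {m n} → Sub m n → Fm m → Fm n
subst σ ⊥' = ⊥'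
subst σ (P a b) = P (substT σ a) (substT σ b)
subst σ (Q a b) = Q (substT σ a) (substT σ b)
subst σ (¬' φ) = ¬' subst σ φ
subst σ (φ ∧' ψ) = subst σ φ ∧' subst σ ψ
subst σ (φ ∨' ψ) = subst σ φ ∨' subst σ ψ
subst σ (φ ⇒' ψ) = subst σ φ ⇒' subst σ ψ
subst σ (∀' φ) = ∀' (subst (liftS σ) φ)
subst σ (∃' φ) = ∃' (subst (liftS σ) φ)

-- C[x\s, y\t] for a formula C whose free variables are among x (= var 0), y (= var 1)
inst : ∀ {n} → Fm 2 → Term n → Term n → Fm n
inst C s t = subst σ C
  where
  σ : Fin 2 → Term _
  σ zero = s
  σ (suc zero) = t

-- A structure has a nonempty domain,
-- Boolean-valued predicates, and a universal-quantifier oracle `all`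
-- specified to be exactly "true on every element" (classically every
-- domain has one; this makes the semantics two-valued as in classical FOL).

record Structure : Set₁ where
  field
    D      : Set
    d₀     : D
    Pᴹ Qᴹ  : D → D → Bool
    r₁ᴹ r₂ᴹ : D
    t₁ᴹ t₂ᴹ : D → D
    all    : (D → Bool) → Bool
    all-sound    : ∀ f → all f ≡ true → ∀ d → f d ≡ true
    all-complete : ∀ f → (∀ d → f d ≡ true) → all f ≡ true

module _ (M : Structure) where
  open Structure M

  extend : ∀ {n} → (Fin n → D) → D → Fin (suc n) → D
  extend ρ d zero = d
  extend ρ d (suc i) = ρ i

  ⟦_⟧t : ∀ {n} → Term n → (Fin n → D) → D
  ⟦ var i ⟧t ρ = ρ i
  ⟦ r₁ ⟧t ρ = r₁ᴹ
  ⟦ r₂ ⟧t ρ = r₂ᴹ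
  ⟦ t₁ s ⟧t ρ = t₁ᴹ (⟦ s ⟧t ρ)
  ⟦ t₂ s ⟧t ρ = t₂ᴹ (⟦ s ⟧t ρ)

  ⟦_⟧ : ∀ {n} → Fm n → (Fin n → D) → Bool
  ⟦ ⊥' ⟧ ρ = false
  ⟦ P a b ⟧ ρ = Pᴹ (⟦ a ⟧t ρ) (⟦ b ⟧t ρ)
  ⟦ Q a b ⟧ ρ = Qᴹ (⟦ a ⟧t ρ) (⟦ b ⟧t ρ)
  ⟦ ¬' φ ⟧ ρ = not (⟦ φ ⟧ ρ)
  ⟦ φ ∧' ψ ⟧ ρ = ⟦ φ ⟧ ρ ∧ ⟦ ψ ⟧ ρ
  ⟦ φ ∨' ψ ⟧ ρ = ⟦ φ ⟧ ρ ∨ ⟦ ψ ⟧ ρ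
  ⟦ φ ⇒' ψ ⟧ ρ = not (⟦ φ ⟧ ρ) ∨ ⟦ ψ ⟧ ρ
  ⟦ ∀' φ ⟧ ρ = all (λ d → ⟦ φ ⟧ (extend ρ d))
  ⟦ ∃' φ ⟧ ρ = not (all (λ d → not (⟦ φ ⟧ (extend ρ d))))

record Sequent (n : ℕ) : Set where
  constructor _⊢_
  field
    ante succ : List (Fm n)

⋀ : ∀ {n} → List (Fm n) → Fm n
⋀ [] = ¬' ⊥'
⋀ (φ ∷ Γ) = φ ∧' ⋀ Γ

⋁ : ∀ {n} → List (Fm n) → Fm n
⋁ [] = ⊥'
⋁ (φ ∷ Δ) = φ ∨' ⋁ Δ

Tautology : ∀ {n} → Sequent n → Set₁
Tautology {n} (Γ ⊢ Δ) =
  (M : Structure) (ρ : Fin n → Structure.D M) → ⟦ M ⟧ (⋀ Γ ⇒' ⋁ Δ) ρ ≡ true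

α β₁ β₂ : Term 3
α = var zero
β₁ = var (suc zero)
β₂ = var (suc (suc zero))

S : Fm 2 → Sequent 3
S C =
  ( (P α (t₁ α) ∧' Q α (t₂ α))
  ∷ ((inst C α (t₁ α) ∨' inst C α (t₂ α)) ⇒' (inst C r₁ β₁ ∧' inst C r₂ β₂))
  ∷ [] )
  ⊢
  ( (P r₁ β₁ ∧' Q r₂ β₂) ∷ [] )

-- In the three-element structure with r₁ = r₂ = a, t₁ and t₂ constantly b and c, P(x, y) ⇔ y = b and
-- Q(x, y) ⇔ y = c, the antecedent P(α,t₁α) ∧ Q(α,t₂α) always holds, while the succedent
-- P(r₁,β₁) ∧ Q(r₂,β₂) fails whenever β₁ = β₂. Validity of S(C) under β₁ = β₂ = d then
-- forces the implication premise C(a,b) ∨ C(a,c) to hold and C(a,d) to fail; taking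
-- d = b and d = c contradicts the premise.
module Submission where

open import Defs
open import Data.Bool using (Bool; true; false; not; _∧_; _∨_)
open import Data.Fin using (Fin; zero; suc; _≟_)
open import Data.Product using (Σ; _×_; _,_)
open import Relation.Nullary using (¬_; does)
import Data.Nat as ℕ
open import Function using (_∘_)
open import Relation.Binary.PropositionalEquality using (_≡_; refl; sym; trans; cong; cong₂)

module Semantics (M : Structure) where
  open Structure M

  all-cong : ∀ f g → (∀ d → f d ≡ g d) → all f ≡ all g
  all-cong f g f≗g with all f in ef | all g in eg
  ... | true  | true  = refl
  ... | false | false = refl
  ... | true  | false = trans (sym (all-complete g (λ d → trans (sym (f≗g d)) (all-sound f ef d)))) eg
  ... | false | true  = trans (sym ef) (all-complete f (λ d → trans (f≗g d) (all-sound g eg d)))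

  ⟦⟧t-weaken : ∀ {n} (s : Term n) ρ d → ⟦ M ⟧t (renT suc s) (extend M ρ d) ≡ ⟦ M ⟧t s ρ
  ⟦⟧t-weaken (var i) ρ d = refl
  ⟦⟧t-weaken r₁      ρ d = refl
  ⟦⟧t-weaken r₂      ρ d = refl
  ⟦⟧t-weaken (t₁ s)  ρ d = cong t₁ᴹ (⟦⟧t-weaken s ρ d)
  ⟦⟧t-weaken (t₂ s)  ρ d = cong t₂ᴹ (⟦⟧t-weaken s ρ d)

  _⊨_↦_ : ∀ {m n} → (Fin n → D) → Sub m n → (Fin m → D) → Set
  ρ ⊨ σ ↦ τ = ∀ i → ⟦ M ⟧t (σ i) ρ ≡ τ i

  ⟦⟧t-subst : ∀ {m n} (s : Term m) {σ : Sub m n} {ρ τ} → ρ ⊨ σ ↦ τ →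
              ⟦ M ⟧t (substT σ s) ρ ≡ ⟦ M ⟧t s τ
  ⟦⟧t-subst (var i) e = e i
  ⟦⟧t-subst r₁      e = refl
  ⟦⟧t-subst r₂      e = refl
  ⟦⟧t-subst (t₁ s)  e = cong t₁ᴹ (⟦⟧t-subst s e)
  ⟦⟧t-subst (t₂ s)  e = cong t₂ᴹ (⟦⟧t-subst s e)

  ⊨-liftS : ∀ {m n} {σ : Sub m n} {ρ τ} → ρ ⊨ σ ↦ τ → ∀ d → extend M ρ d ⊨ liftS σ ↦ extend M τ d
  ⊨-liftS e d zero    = refl
  ⊨-liftS {σ = σ} {ρ} e d (suc i) = trans (⟦⟧t-weaken (σ i) ρ d) (e i)

  ⟦⟧-subst : ∀ {m n} (φ : Fm m) {σ : Sub m n} {ρ τ} → ρ ⊨ σ ↦ τ → ⟦ M ⟧ (subst σ φ) ρ ≡ ⟦ M ⟧ φ τ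
  ⟦⟧-subst ⊥'       e = refl
  ⟦⟧-subst (P a b)  e = cong₂ Pᴹ (⟦⟧t-subst a e) (⟦⟧t-subst b e)
  ⟦⟧-subst (Q a b)  e = cong₂ Qᴹ (⟦⟧t-subst a e) (⟦⟧t-subst b e)
  ⟦⟧-subst (¬' φ)   e = cong not (⟦⟧-subst φ e)
  ⟦⟧-subst (φ ∧' ψ) e = cong₂ _∧_ (⟦⟧-subst φ e) (⟦⟧-subst ψ e)
  ⟦⟧-subst (φ ∨' ψ) e = cong₂ _∨_ (⟦⟧-subst φ e) (⟦⟧-subst ψ e)
  ⟦⟧-subst (φ ⇒' ψ) e = cong₂ (λ x y → not x ∨ y) (⟦⟧-subst φ e) (⟦⟧-subst ψ e)
  ⟦⟧-subst (∀' φ)   e = all-cong _ _ (λ d → ⟦⟧-subst φ (⊨-liftS e d))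
  ⟦⟧-subst (∃' φ)   e = cong not (all-cong _ _ (λ d → cong not (⟦⟧-subst φ (⊨-liftS e d))))

  [_,_] : D → D → Fin 2 → D
  [ x , y ] zero       = x
  [ x , y ] (suc zero) = y

  ⟦⟧-inst : ∀ {n} (C : Fm 2) (s t : Term n) ρ →
            ⟦ M ⟧ (inst C s t) ρ ≡ ⟦ M ⟧ C [ ⟦ M ⟧t s ρ , ⟦ M ⟧t t ρ ]
  ⟦⟧-inst C s t ρ = ⟦⟧-subst C λ { zero → refl ; (suc zero) → refl }

allFin : ∀ {n} → (Fin n → Bool) → Bool
allFin {ℕ.zero}  f = true
allFin {ℕ.suc n} f = f zero ∧ allFin (f ∘ suc)

allFin-sound : ∀ {n} (f : Fin n → Bool) → allFin f ≡ true → ∀ i → f i ≡ true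
allFin-sound {ℕ.suc n} f e i with f zero in f0
allFin-sound {ℕ.suc n} f e zero    | true = f0
allFin-sound {ℕ.suc n} f e (suc i) | true = allFin-sound (f ∘ suc) e i

allFin-complete : ∀ {n} (f : Fin n → Bool) → (∀ i → f i ≡ true) → allFin f ≡ true
allFin-complete {ℕ.zero}  f f≡true = refl
allFin-complete {ℕ.suc n} f f≡true = cong₂ _∧_ (f≡true zero) (allFin-complete (f ∘ suc) (f≡true ∘ suc))

a b c : Fin 3
a = zero
b = suc zero
c = suc (suc zero)

M : Structure
M = record
  { D = Fin 3 ; d₀ = a
  ; Pᴹ = λ _ y → does (y ≟ b) ; Qᴹ = λ _ y → does (y ≟ c)
  ; r₁ᴹ = a ; r₂ᴹ = a
  ; t₁ᴹ = λ _ → b ; t₂ᴹ = λ _ → c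
  ; all = allFin ; all-sound = allFin-sound ; all-complete = allFin-complete
  }

open Semantics M

diagonal : Fin 3 → Fin 3 → Fin 3
diagonal d zero    = a
diagonal d (suc _) = d

sequentFm : ∀ {n} → Sequent n → Fm n
sequentFm (Γ ⊢ Δ) = ⋀ Γ ⇒' ⋁ Δ

premise-holds-conclusion-fails : ∀ {p w} → not ((not p ∨ (w ∧ w)) ∧ true) ∨ false ≡ true →
                                 p ≡ true × w ≡ false
premise-holds-conclusion-fails {true} {false} _ = refl , refl
premise-holds-conclusion-fails {true} {true}  ()
premise-holds-conclusion-fails {false}        ()

succedent-fails-on-diagonal : ∀ d → does (d ≟ b) ∧ does (d ≟ c) ≡ false
succedent-fails-on-diagonal zero             = refl
succedent-fails-on-diagonal (suc zero)       = refl
succedent-fails-on-diagonal (suc (suc zero)) = refl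

-- The trailing ∧ true and ∨ false are the empty tails of ⋀ and ⋁.
⟦S⟧-diagonal : ∀ C d →
  ⟦ M ⟧ (sequentFm (S C)) (diagonal d) ≡
  not ((not (⟦ M ⟧ C [ a , b ] ∨ ⟦ M ⟧ C [ a , c ]) ∨ (⟦ M ⟧ C [ a , d ] ∧ ⟦ M ⟧ C [ a , d ])) ∧ true) ∨ false
⟦S⟧-diagonal C d
  rewrite ⟦⟧-inst C α (t₁ α) (diagonal d) | ⟦⟧-inst C α (t₂ α) (diagonal d)
        | ⟦⟧-inst C r₁ β₁ (diagonal d)    | ⟦⟧-inst C r₂ β₂ (diagonal d)
        | succedent-fails-on-diagonal d = refl

valid-on-diagonal : ∀ C → Tautology (S C) → ∀ d →
                    ⟦ M ⟧ C [ a , b ] ∨ ⟦ M ⟧ C [ a , c ] ≡ true × ⟦ M ⟧ C [ a , d ] ≡ false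
valid-on-diagonal C taut d =
  premise-holds-conclusion-fails (trans (sym (⟦S⟧-diagonal C d)) (taut M (diagonal d)))

lemma1 : ¬ (Σ (Fm 2) (λ C → Tautology (S C)))
lemma1 (C , taut) with valid-on-diagonal C taut b | valid-on-diagonal C taut c
... | premise , C[a,b]≡false | _ , C[a,c]≡false
  with () ← trans (sym (cong₂ _∨_ C[a,b]≡false C[a,c]≡false)) premise
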